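{- Let $T$ be a tree rooted at a vertex $v$, let $S$ be a dominating set of $T$, let $A\subseteq a_1(S)$, let $N=N(A)\cap N_1(S)$, and let $S'=(S\setminus A)\cup N$. Suppose every vertex of $A$ has the same depth in $T$. Then (i) $|S'|\ge|S|$; (ii) every vertex of $A$ and every descendant of a vertex of $A$ is dominated by $S'$ (i.e. lies in $S'$ or has a neighbour in $S'$). If in addition $S'$ is a dominating set and every vertex of $N$ is a child of some vertex of $A$, then (iii) no vertex of $N$ is adjacent to any other vertex of $S'$, and hence $N\subseteq a(S')$; (iv) every vertex $x\in a(S)$ with $x\in S'\setminus a(S')$ is a grandchild of some vertex of $N$, and the parent of $x$ is not in $S'$.
   Context: A dominating set of a graph $G=(V,E)$ is a set $S\subseteq V$ with $N[S]=V$, where $N[v]$ is the closed neighbourhood and $N(v)$ the open neighbourhood; for a set $A$, $N(A)=\bigcup_{a\in A}N(a)$. For a dominating set $S$: $a(S)=\{u\in S: S\setminus\{u\}\text{ is not dominating}\}$; $N_1(S)=\{u\in V\setminus S: |N[u]\cap S|=1\}$; $N_2(S)=\{u\in V\setminus S:|N[u]\cap S|\ge2\}$; $a_1(S)=\{u\in a(S): N[u]\cap N_1(S)\ne\emptyset\}$; $a_2(S)=a(S)\setminus a_1(S)$. In a tree rooted at $v$, the depth of a vertex is its distance to $v$; $x$ is a descendant of $y$ if $y$ lies on the path from $x$ to $v$; a child (grandchild) of $y$ is a descendant at distance 1 (2) from $y$, and $y$ is then its parent (grandparent). -}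

module Defs where

open import Data.Nat using (ℕ; zero; suc; _≤_; _≟_)
open import Data.Bool using (Bool; true; false; _∧_; _∨_; not)
open import Data.Fin using (Fin)
import Data.Fin as F
open import Data.Fin.Subset using (Subset; _∈_; _∉_; _∩_; _∪_; _─_; _-_; ∣_∣)
open import Data.Vec using (tabulate; lookup)
open import Data.List using (List; []; _∷_; length; head; last; allFin)
open import Data.Bool.ListAction using (any)
open import Data.List.Relation.Unary.Linked using (Linked)
open import Data.List.Relation.Unary.Unique.Propositional using (Unique)
import Data.List.Membership.Propositional as LM
open import Data.Maybe using (Maybe; just)
open import Data.Product using (Σ; ∃; _×_; _,_)
open import Data.Sum using (_⊎_)
open import Relation.Nullary using (¬_; does)
open import Relation.Binary.PropositionalEquality using (_≡_; _≢_)

record Graph (n : ℕ) : Set where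
  field
    adj    : Fin n → Fin n → Bool
    sym    : ∀ x y → adj x y ≡ adj y x
    irrefl : ∀ x → adj x x ≡ false
open Graph public

module _ {n : ℕ} (G : Graph n) where

  Adjacent : Fin n → Fin n → Set
  Adjacent x y = adj G x y ≡ true

  IsPath : Fin n → Fin n → List (Fin n) → Set
  IsPath u w xs = head xs ≡ just u × last xs ≡ just w
                × Linked Adjacent xs × Unique xs

  IsCycle : List (Fin n) → Set
  IsCycle xs = 3 ≤ length xs × Linked Adjacent xs × Unique xs
             × Σ (Fin n) λ u → Σ (Fin n) λ w →
                 head xs ≡ just u × last xs ≡ just w × Adjacent w u

  Connected : Set
  Connected = ∀ u w → ∃ λ xs → IsPath u w xs

  Acyclic : Set
  Acyclic = ∀ xs → ¬ IsCycle xs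

  IsTree : Set
  IsTree = Connected × Acyclic

  Dist : Fin n → Fin n → ℕ → Set
  Dist u w d = (∃ λ xs → IsPath u w xs × length xs ≡ suc d)
             × (∀ xs → IsPath u w xs → suc d ≤ length xs)

  Depth : (r : Fin n) → Fin n → ℕ → Set
  Depth r x d = Dist x r d

  Descendant : (r : Fin n) → Fin n → Fin n → Set
  Descendant r x y = ∃ λ xs → IsPath x r xs × y LM.∈ xs

  Child : (r : Fin n) → Fin n → Fin n → Set
  Child r x y = Descendant r x y × Dist x y 1

  Grandchild : (r : Fin n) → Fin n → Fin n → Set
  Grandchild r x y = Descendant r x y × Dist x y 2

  closedNbhd : Fin n → Subset n
  closedNbhd u = tabulate λ w → does (w F.≟ u) ∨ adj G u w

  openNbhdSet : Subset n → Subset n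
  openNbhdSet A = tabulate λ u → any (λ w → lookup A w ∧ adj G w u) (allFin n)

  Dominated : Subset n → Fin n → Set
  Dominated S u = u ∈ S ⊎ (∃ λ w → w ∈ S × Adjacent u w)

  Dominating : Subset n → Set
  Dominating S = ∀ u → Dominated S u

  InA : Subset n → Fin n → Set
  InA S u = u ∈ S × ¬ Dominating (S - u)

  N₁ : Subset n → Subset n
  N₁ S = tabulate λ u → not (lookup S u) ∧ does (∣ closedNbhd u ∩ S ∣ ≟ 1)

  N₂ : Subset n → Subset n
  N₂ S = tabulate λ u → not (lookup S u) ∧ not (does (∣ closedNbhd u ∩ S ∣ ≟ 0))
                                         ∧ not (does (∣ closedNbhd u ∩ S ∣ ≟ 1))

  InA₁ : Subset n → Fin n → Set
  InA₁ S u = InA S u × (∃ λ w → w ∈ closedNbhd u × w ∈ N₁ S)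

  InA₂ : Subset n → Fin n → Set
  InA₂ S u = InA S u × ¬ (∃ λ w → w ∈ closedNbhd u × w ∈ N₁ S)

{-# OPTIONS --safe #-}
-- Each a ∈ A ⊆ a₁(S) has a neighbour in N₁(S), whose only S-neighbour is a; replacing
-- every a ∈ A by such a private neighbour embeds S into S′, which gives (i).  Since A lies
-- at a single depth, a descendant of a vertex of A has at most one neighbour in A, namely
-- its parent; so a descendant outside S whose S-neighbour lies in A is either in N₁(S),
-- hence in N, or has a second S-neighbour, outside A, which gives (ii).  If N consists of
-- children of A, then N lies at a single depth and is therefore independent, while the
-- only S-neighbour of a vertex of N lies in A; this gives (iii).  For (iv), x ∉ a(S′)
-- means that S′ ∖ {x} still dominates, so a private neighbour u of x with respect to S is
-- adjacent to some z ∈ N.  As u ∉ S, u is not the parent of z (which lies in A), and as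
-- z ∉ S, z is not x; so x is a child of u, which is a child of z.
module Submission where

open import Defs
open import Data.Bool using (Bool; true; T; not)
import Data.Bool as Bool
open import Data.Bool.Properties using (T-≡; T-not-≡; T-∧; T-∨; ¬-not; not-¬)
open import Data.Empty using (⊥-elim)
open import Data.Fin using (Fin; zero; suc; _≟_)
import Data.Fin.Properties as Fin
open import Data.Fin.Properties using (any?; all?; ¬∀⟶∃¬)
open import Data.Fin.Subset using (Subset; inside; outside; _∈_; _∉_; _⊆_; _∩_; _∪_; _─_; _-_; ⁅_⁆; ∣_∣)
open import Data.Fin.Subset.Properties
  using (_∈?_; nonempty?; x∈p∩q⁺; x∈p∩q⁻; x∈p∪q⁺; x∈p∪q⁻; x∈p∧x∉q⇒x∈p─q; x∈⁅x⁆; ∣⁅x⁆∣≡1; x∉⁅y⁆⇒x≢y;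
         p⊆q⇒∣p∣≤∣q∣; p─q⊆p; x∈p∧x≢y⇒x∈p-y; x∈p⇒∣p-x∣<∣p∣)
open import Data.List using (List; []; _∷_; length; allFin; head; last)
open import Data.List.Membership.Propositional using (lose) renaming (_∈_ to _∈ₗ_; _∉_ to _∉ₗ_)
open import Data.List.Membership.Propositional.Properties using (∈-allFin)
open import Data.List.Properties using (∷-injectiveʳ)
open import Data.List.Relation.Unary.All using (All; []; _∷_)
import Data.List.Relation.Unary.All as All
open import Data.List.Relation.Unary.All.Properties using (¬Any⇒All¬)
open import Data.List.Relation.Unary.AllPairs using ([]; _∷_)
open import Data.List.Relation.Unary.Any using (here; there; satisfied)
import Data.List.Relation.Unary.Any as Any
open import Data.List.Relation.Unary.Any.Properties using (any⁺; any⁻)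
open import Data.List.Relation.Unary.Linked using (Linked; [-]; _∷_)
open import Data.List.Relation.Unary.Unique.Propositional using (Unique)
open import Data.List.Relation.Unary.Unique.Propositional.Properties using (Unique[x∷xs]⇒x∉xs)
open import Data.Maybe using (just)
open import Data.Maybe.Properties using (just-injective)
open import Data.Nat using (ℕ; suc; _≤_; _<_; z≤n; s≤s)
import Data.Nat as ℕ
open import Data.Nat.Properties
  using (1+n≢n; 1+n≰n; ≤-reflexive; m≤n⇒m≤1+n; ≤-trans; ≤-<-trans; ≤-antisym; <-irrefl)
open import Data.Product using (∃; _×_; _,_; proj₁; proj₂)
open import Data.Sum using (_⊎_; inj₁; inj₂)
open import Data.Vec using (_∷_; []; here; there; lookup; tabulate)
open import Data.Vec.Properties using (lookup∘tabulate; []=⇒lookup; lookup⇒[]=)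
open import Function using (_∘_; Equivalence)
open import Relation.Binary.PropositionalEquality as ≡ using (_≡_; _≢_; refl; trans; subst)
open import Relation.Nullary using (¬_; Dec; yes; no; does; contradiction)
open import Relation.Nullary.Decidable using (dec-true; decidable-stable; _⊎-dec_; _×-dec_)
open import Relation.Unary using (Decidable)

open Equivalence using (to; from)

private
  variable
    m n : ℕ
    x y : Fin n
    p q : Subset n

T-does⇒ : ∀ {P : Set} (P? : Dec P) → T (does P?) → P
T-does⇒ (yes p) _ = p

T-does⇐ : ∀ {P : Set} (P? : Dec P) → P → T (does P?)
T-does⇐ P? = from T-≡ ∘ dec-true P?

∉⇒T-not : x ∉ p → T (not (lookup p x))
∉⇒T-not {x = x} {p = p} x∉p = from T-not-≡ (¬-not (x∉p ∘ lookup⇒[]= x p))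

T-not⇒∉ : T (not (lookup p x)) → x ∉ p
T-not⇒∉ t x∈p = not-¬ ([]=⇒lookup x∈p) (to T-not-≡ t)

∈⇒T : x ∈ p → T (lookup p x)
∈⇒T x∈p = from T-≡ ([]=⇒lookup x∈p)

T⇒∈ : T (lookup p x) → x ∈ p
T⇒∈ {p = p} {x = x} t = lookup⇒[]= x p (to T-≡ t)

∈-tabulate⁺ : {f : Fin n → Bool} → T (f x) → x ∈ tabulate f
∈-tabulate⁺ {x = x} {f = f} = T⇒∈ ∘ subst T (≡.sym (lookup∘tabulate f x))

∈-tabulate⁻ : {f : Fin n → Bool} → x ∈ tabulate f → T (f x)
∈-tabulate⁻ {x = x} {f = f} = subst T (lookup∘tabulate f x) ∘ ∈⇒T

x∈p─q⇒x∉q : x ∈ p ─ q → x ∉ q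
x∈p─q⇒x∉q {p = _ ∷ _} {q = _ ∷ _} (there x∈p─q) (there x∈q) = x∈p─q⇒x∉q x∈p─q x∈q

x∈p-y⇒x∈p∧x≢y : x ∈ p - y → x ∈ p × x ≢ y
x∈p-y⇒x∈p∧x≢y {p = p} {y = y} x∈p-y = p─q⊆p p ⁅ y ⁆ x∈p-y , x∉⁅y⁆⇒x≢y (x∈p─q⇒x∉q x∈p-y)

x∈p⇒1≤∣p∣ : x ∈ p → 1 ≤ ∣ p ∣
x∈p⇒1≤∣p∣ x∈p = ≤-trans (s≤s z≤n) (x∈p⇒∣p-x∣<∣p∣ x∈p)

x∈p∧y∈p∧∣p∣≡1⇒x≡y : x ∈ p → y ∈ p → ∣ p ∣ ≡ 1 → x ≡ y
x∈p∧y∈p∧∣p∣≡1⇒x≡y {x = x} {p = p} {y = y} x∈p y∈p ∣p∣≡1 with x ≟ y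
... | yes x≡y = x≡y
... | no x≢y = contradiction (subst (1 <_) ∣p∣≡1 1<∣p∣) (<-irrefl refl)
  where
  1<∣p∣ : 1 < ∣ p ∣
  1<∣p∣ = ≤-<-trans (x∈p⇒1≤∣p∣ (x∈p∧x≢y⇒x∈p-y y∈p (x≢y ∘ ≡.sym))) (x∈p⇒∣p-x∣<∣p∣ x∈p)

x∈p∧∣p∣≢1⇒∃y≢x : x ∈ p → ∣ p ∣ ≢ 1 → ∃ λ y → y ∈ p × y ≢ x
x∈p∧∣p∣≢1⇒∃y≢x {x = x} {p = p} x∈p ∣p∣≢1 with nonempty? (p - x)
... | yes (y , y∈p-x) = y , x∈p-y⇒x∈p∧x≢y y∈p-x
... | no p-x≡∅ = contradiction (≤-antisym ∣p∣≤1 (x∈p⇒1≤∣p∣ x∈p)) ∣p∣≢1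
  where
  p⊆⁅x⁆ : p ⊆ ⁅ x ⁆
  p⊆⁅x⁆ {y} y∈p with y ≟ x
  ... | yes refl = x∈⁅x⁆ x
  ... | no y≢x = contradiction (y , x∈p∧x≢y⇒x∈p-y y∈p y≢x) p-x≡∅
  ∣p∣≤1 : ∣ p ∣ ≤ 1
  ∣p∣≤1 = subst (∣ p ∣ ≤_) (∣⁅x⁆∣≡1 x) (p⊆q⇒∣p∣≤∣q∣ p⊆⁅x⁆)

injectiveOn⇒∣p∣≤∣q∣ : (f : Fin m → Fin n) → (∀ {i} → i ∈ p → f i ∈ q)
                    → (∀ {i j} → i ∈ p → j ∈ p → f i ≡ f j → i ≡ j) → ∣ p ∣ ≤ ∣ q ∣
injectiveOn⇒∣p∣≤∣q∣ {p = []} f _ _ = z≤n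
injectiveOn⇒∣p∣≤∣q∣ {p = outside ∷ p} f into inj =
  injectiveOn⇒∣p∣≤∣q∣ (f ∘ suc) (into ∘ there) (λ i∈p j∈p → Fin.suc-injective ∘ inj (there i∈p) (there j∈p))
injectiveOn⇒∣p∣≤∣q∣ {p = inside ∷ p} {q = q} f into inj =
  ≤-trans (s≤s (injectiveOn⇒∣p∣≤∣q∣ (f ∘ suc) into-q-f0 inj-suc)) (x∈p⇒∣p-x∣<∣p∣ (into here))
  where
  inj-suc : ∀ {i j} → i ∈ p → j ∈ p → f (suc i) ≡ f (suc j) → i ≡ j
  inj-suc i∈p j∈p = Fin.suc-injective ∘ inj (there i∈p) (there j∈p)
  into-q-f0 : ∀ {i} → i ∈ p → f (suc i) ∈ q - f zero
  into-q-f0 i∈p = x∈p∧x≢y⇒x∈p-y (into (there i∈p)) (Fin.0≢1+n ∘ inj here (there i∈p) ∘ ≡.sym)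

module _ (G : Graph n) where

  adjacent-sym : Adjacent G x y → Adjacent G y x
  adjacent-sym {x = x} {y = y} = trans (sym G y x)

  adjacent-irrefl : ¬ Adjacent G x x
  adjacent-irrefl {x = x} x~x = contradiction (trans (≡.sym x~x) (irrefl G x)) λ ()

  adjacent⇒∈closedNbhd : Adjacent G x y → y ∈ closedNbhd G x
  adjacent⇒∈closedNbhd x~y = ∈-tabulate⁺ (from T-∨ (inj₂ (from T-≡ x~y)))

  ∈closedNbhd⇒adjacent : y ∈ closedNbhd G x → y ≢ x → Adjacent G x y
  ∈closedNbhd⇒adjacent {y = y} {x = x} y∈N[x] y≢x with to T-∨ (∈-tabulate⁻ y∈N[x])
  ... | inj₁ y≟x = contradiction (T-does⇒ (y ≟ x) y≟x) y≢x
  ... | inj₂ x~y = to T-≡ x~y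

  ∈openNbhdSet⁺ : ∀ {A a} → a ∈ A → Adjacent G a x → x ∈ openNbhdSet G A
  ∈openNbhdSet⁺ {a = a} a∈A a~x =
    ∈-tabulate⁺ (any⁺ _ (lose (∈-allFin a) (from T-∧ (∈⇒T a∈A , from T-≡ a~x))))

  ∈openNbhdSet⁻ : ∀ {A} → x ∈ openNbhdSet G A → ∃ λ a → a ∈ A × Adjacent G a x
  ∈openNbhdSet⁻ x∈N[A] with satisfied (any⁻ _ (allFin n) (∈-tabulate⁻ x∈N[A]))
  ... | a , t with to T-∧ t
  ... | a∈A , a~x = a , T⇒∈ a∈A , to T-≡ a~x

  ∈N₁⁻ : ∀ {S} → x ∈ N₁ G S → x ∉ S × ∣ closedNbhd G x ∩ S ∣ ≡ 1
  ∈N₁⁻ {x = x} {S = S} x∈N₁ with to T-∧ (∈-tabulate⁻ x∈N₁)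
  ... | x∉S , ∣N[x]∩S∣≡1 = T-not⇒∉ x∉S , T-does⇒ (∣ closedNbhd G x ∩ S ∣ ℕ.≟ 1) ∣N[x]∩S∣≡1

  ∈N₁⁺ : ∀ {S} → x ∉ S → ∣ closedNbhd G x ∩ S ∣ ≡ 1 → x ∈ N₁ G S
  ∈N₁⁺ {x = x} {S = S} x∉S ∣N[x]∩S∣≡1 =
    ∈-tabulate⁺ (from T-∧ (∉⇒T-not x∉S , T-does⇐ (∣ closedNbhd G x ∩ S ∣ ℕ.≟ 1) ∣N[x]∩S∣≡1))

  N₁-unique-neighbour : ∀ {S s s′} → x ∈ N₁ G S → s ∈ S → s′ ∈ S
                      → Adjacent G x s → Adjacent G x s′ → s ≡ s′
  N₁-unique-neighbour x∈N₁ s∈S s′∈S x~s x~s′ =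
    x∈p∧y∈p∧∣p∣≡1⇒x≡y (x∈p∩q⁺ (adjacent⇒∈closedNbhd x~s , s∈S))
                      (x∈p∩q⁺ (adjacent⇒∈closedNbhd x~s′ , s′∈S)) (proj₂ (∈N₁⁻ x∈N₁))

  ∉N₁⇒another-neighbour : ∀ {S s} → x ∉ S → x ∉ N₁ G S → s ∈ S → Adjacent G x s
                        → ∃ λ s′ → s′ ∈ S × s′ ≢ s × Adjacent G x s′
  ∉N₁⇒another-neighbour {S = S} x∉S x∉N₁ s∈S x~s
    with x∈p∧∣p∣≢1⇒∃y≢x (x∈p∩q⁺ (adjacent⇒∈closedNbhd x~s , s∈S)) (x∉N₁ ∘ ∈N₁⁺ x∉S)
  ... | s′ , s′∈N[x]∩S , s′≢s with x∈p∩q⁻ _ _ s′∈N[x]∩S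
  ... | s′∈N[x] , s′∈S =
    s′ , s′∈S , s′≢s , ∈closedNbhd⇒adjacent s′∈N[x] (λ s′≡x → x∉S (subst (_∈ S) s′≡x s′∈S))

  InA₁⇒N₁-neighbour : ∀ {S} → InA₁ G S x → ∃ λ w → w ∈ N₁ G S × Adjacent G x w
  InA₁⇒N₁-neighbour {S = S} ((x∈S , _) , w , w∈N[x] , w∈N₁) =
    w , w∈N₁ , ∈closedNbhd⇒adjacent w∈N[x] (λ w≡x → proj₁ (∈N₁⁻ w∈N₁) (subst (_∈ S) (≡.sym w≡x) x∈S))

  dominated? : ∀ S → Decidable (Dominated G S)
  dominated? S x = x ∈? S ⊎-dec any? (λ w → w ∈? S ×-dec adj G x w Bool.≟ true)

  InA⇒∃undominated : ∀ {S} → InA G S x → ∃ λ u → ¬ Dominated G (S - x) u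
  InA⇒∃undominated (_ , ¬dominating) = ¬∀⟶∃¬ n _ (dominated? _) ¬dominating

  ¬InA⇒dominating : ∀ {S} → x ∈ S → ¬ InA G S x → Dominating G (S - x)
  ¬InA⇒dominating x∈S ¬InA = decidable-stable (all? (dominated? _)) (¬InA ∘ (x∈S ,_))

module _ {a} {A : Set a} where

  takeThrough : ∀ {y : A} {xs} → y ∈ₗ xs → List A
  takeThrough {xs = x ∷ _}  (here _)     = x ∷ []
  takeThrough {xs = x ∷ _}  (there y∈xs) = x ∷ takeThrough y∈xs

  module _ {y : A} where

    1≤length-takeThrough : ∀ {xs} (y∈xs : y ∈ₗ xs) → 1 ≤ length (takeThrough y∈xs)
    1≤length-takeThrough {xs = _ ∷ _} (here _)  = s≤s z≤n
    1≤length-takeThrough {xs = _ ∷ _} (there _) = s≤s z≤n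

    last-takeThrough : ∀ x {xs} (y∈xs : y ∈ₗ xs) → last (x ∷ takeThrough y∈xs) ≡ just y
    last-takeThrough x {_ ∷ _} (here refl)  = refl
    last-takeThrough x {_ ∷ _} (there y∈xs) = last-takeThrough _ y∈xs

    All-takeThrough : ∀ {p} {P : A → Set p} {xs} (y∈xs : y ∈ₗ xs) → All P xs → All P (takeThrough y∈xs)
    All-takeThrough (here _)     (px ∷ _)   = px ∷ []
    All-takeThrough (there y∈xs) (px ∷ pxs) = px ∷ All-takeThrough y∈xs pxs

    Unique-takeThrough : ∀ {xs} (y∈xs : y ∈ₗ xs) → Unique xs → Unique (takeThrough y∈xs)
    Unique-takeThrough (here _)     (_ ∷ _)      = [] ∷ []
    Unique-takeThrough (there y∈xs) (x∉xs ∷ xs!) = All-takeThrough y∈xs x∉xs ∷ Unique-takeThrough y∈xs xs!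

    Linked-takeThrough : ∀ {ℓ} {R : A → A → Set ℓ} {x xs} (y∈xs : y ∈ₗ xs)
                       → Linked R (x ∷ xs) → Linked R (x ∷ takeThrough y∈xs)
    Linked-takeThrough (here _)     (Rxy ∷ _)       = Rxy ∷ [-]
    Linked-takeThrough (there y∈xs) (Rxy ∷ linked) = Rxy ∷ Linked-takeThrough y∈xs linked

    last≡just⇒∈ : ∀ xs → last xs ≡ just y → y ∈ₗ xs
    last≡just⇒∈ (_ ∷ [])     refl = here refl
    last≡just⇒∈ (_ ∷ x ∷ xs) eq   = there (last≡just⇒∈ (x ∷ xs) eq)

module _ (G : Graph n) where

  IsPath-tail : ∀ {u v w xs} → IsPath G u w (u ∷ v ∷ xs) → IsPath G v w (v ∷ xs)
  IsPath-tail (refl , last≡w , (_ ∷ linked) , (_ ∷ unique)) = refl , last≡w , linked , unique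

  IsPath-cons : ∀ {u v w xs} → Adjacent G u v → u ∉ₗ xs → IsPath G v w xs → IsPath G u w (u ∷ xs)
  IsPath-cons {xs = _ ∷ _} u~v u∉xs (refl , last≡w , linked , unique) =
    refl , last≡w , u~v ∷ linked , ¬Any⇒All¬ _ u∉xs ∷ unique

  module _ (acyclic : Acyclic G) where

    IsPath-through-neighbour : ∀ {u v w xs} → IsPath G u w xs → Adjacent G u v → v ∈ₗ xs
                             → ∃ λ ys → xs ≡ u ∷ v ∷ ys
    IsPath-through-neighbour (refl , _) u~v (here refl) = contradiction u~v (adjacent-irrefl G)
    IsPath-through-neighbour {xs = _ ∷ _ ∷ xs} (refl , _) _ (there (here refl)) = xs , refl
    IsPath-through-neighbour {u = u} {v = v} {xs = u ∷ x ∷ xs} (refl , _ , linked , (u∉ ∷ unique)) u~v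
                             (there (there v∈xs)) = ⊥-elim (acyclic _ cycle)
      where
      v∈x∷xs : v ∈ₗ x ∷ xs
      v∈x∷xs = there v∈xs
      cycle : IsCycle G (u ∷ takeThrough v∈x∷xs)
      cycle = s≤s (s≤s (1≤length-takeThrough v∈xs))
            , Linked-takeThrough v∈x∷xs linked
            , All-takeThrough v∈x∷xs u∉ ∷ Unique-takeThrough v∈x∷xs unique
            , u , v , refl , last-takeThrough u v∈x∷xs , adjacent-sym G u~v

    private
      IsPath-unique-step : ∀ {u v w xs ys} → IsPath G u w (u ∷ v ∷ xs) → IsPath G u w ys
                         → (∀ {zs} → IsPath G v w zs → v ∷ xs ≡ zs) → u ∷ v ∷ xs ≡ ys
      IsPath-unique-step {u = u} {v = v} {ys = u ∷ ys}
                         (refl , _ , u~v ∷ _ , (u∉ ∷ _)) ys-path@(refl , _) unique-from-v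
        with Any.any? (v ≟_) (u ∷ ys)
      ... | no v∉ys =
        contradiction (unique-from-v (IsPath-cons (adjacent-sym G u~v) v∉ys ys-path))
                      (λ eq → All.lookup u∉ (subst (u ∈ₗ_) (≡.sym eq) (there (here refl))) refl)
      ... | yes v∈ys with IsPath-through-neighbour ys-path u~v v∈ys
      ...   | zs , refl = ≡.cong (u ∷_) (unique-from-v (IsPath-tail ys-path))

    IsPath-unique : ∀ {u w xs ys} → IsPath G u w xs → IsPath G u w ys → xs ≡ ys
    IsPath-unique {xs = []} (() , _)
    IsPath-unique {xs = u ∷ []} {ys = _ ∷ []} (refl , _) (refl , _) = refl
    IsPath-unique {xs = u ∷ []} {ys = _ ∷ y ∷ ys} (refl , refl , _) (refl , last≡u , _ , (u∉ ∷ _)) =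
      contradiction refl (All.lookup u∉ (last≡just⇒∈ (y ∷ ys) last≡u))
    IsPath-unique {xs = u ∷ v ∷ xs} xs-path@(refl , _) ys-path =
      IsPath-unique-step xs-path ys-path (IsPath-unique (IsPath-tail xs-path))

module RootedTree (G : Graph n) (tree : IsTree G) (r : Fin n) where

  private
    acyclic : Acyclic G
    acyclic = proj₂ tree

  pathToRoot : Fin n → List (Fin n)
  pathToRoot x = proj₁ (proj₁ tree x r)

  pathToRoot-isPath : ∀ x → IsPath G x r (pathToRoot x)
  pathToRoot-isPath x = proj₂ (proj₁ tree x r)

  IsPath⇒≡pathToRoot : ∀ {x xs} → IsPath G x r xs → xs ≡ pathToRoot x
  IsPath⇒≡pathToRoot x⇝r = IsPath-unique G acyclic x⇝r (pathToRoot-isPath _)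

  pathToRoot-injective : pathToRoot x ≡ pathToRoot y → x ≡ y
  pathToRoot-injective {x = x} {y = y} eq =
    just-injective (trans (≡.sym (proj₁ (pathToRoot-isPath x)))
                          (trans (≡.cong head eq) (proj₁ (pathToRoot-isPath y))))

  adjacent⇒parent⊎child : Adjacent G x y → pathToRoot x ≡ x ∷ pathToRoot y ⊎ pathToRoot y ≡ y ∷ pathToRoot x
  adjacent⇒parent⊎child {x = x} {y = y} x~y with Any.any? (x ≟_) (pathToRoot y)
  ... | no x∉ = inj₁ (≡.sym (IsPath⇒≡pathToRoot (IsPath-cons G x~y x∉ (pathToRoot-isPath y))))
  ... | yes x∈ with IsPath-through-neighbour G acyclic (pathToRoot-isPath y) (adjacent-sym G x~y) x∈
  ...   | xs , y∷x∷xs = inj₂ (trans y∷x∷xs (≡.cong (y ∷_) (IsPath⇒≡pathToRoot x∷xs-path)))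
    where
    x∷xs-path : IsPath G x r (x ∷ xs)
    x∷xs-path = IsPath-tail G (subst (IsPath G y r) y∷x∷xs (pathToRoot-isPath y))

  adjacent⇒length≢ : Adjacent G x y → length (pathToRoot x) ≢ length (pathToRoot y)
  adjacent⇒length≢ x~y ∣x∣≡∣y∣ with adjacent⇒parent⊎child x~y
  ... | inj₁ eq = 1+n≢n (trans (≡.sym (≡.cong length eq)) ∣x∣≡∣y∣)
  ... | inj₂ eq = 1+n≢n (trans (≡.sym (≡.cong length eq)) (≡.sym ∣x∣≡∣y∣))

  Depth⇒length≡ : ∀ {d} → Depth G r x d → length (pathToRoot x) ≡ suc d
  Depth⇒length≡ ((xs , x⇝r , ∣xs∣≡1+d) , _) = trans (≡.cong length (≡.sym (IsPath⇒≡pathToRoot x⇝r))) ∣xs∣≡1+d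

  Descendant⇒∈pathToRoot : Descendant G r x y → y ∈ₗ pathToRoot x
  Descendant⇒∈pathToRoot (xs , x⇝r , y∈xs) = subst (_ ∈ₗ_) (IsPath⇒≡pathToRoot x⇝r) y∈xs

  ∈IsPath⇒length≤ : ∀ {xs} → IsPath G x r xs → y ∈ₗ xs → length (pathToRoot y) ≤ length xs
  ∈IsPath⇒length≤ x⇝r@(refl , _) (here refl) = ≤-reflexive (≡.cong length (≡.sym (IsPath⇒≡pathToRoot x⇝r)))
  ∈IsPath⇒length≤ {xs = _ ∷ _ ∷ _} x⇝r@(refl , _) (there y∈xs) =
    m≤n⇒m≤1+n (∈IsPath⇒length≤ (IsPath-tail G x⇝r) y∈xs)

  Descendant⇒length≤ : Descendant G r x y → length (pathToRoot y) ≤ length (pathToRoot x)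
  Descendant⇒length≤ = ∈IsPath⇒length≤ (pathToRoot-isPath _) ∘ Descendant⇒∈pathToRoot

  Child⇒pathToRoot : Child G r x y → pathToRoot x ≡ x ∷ pathToRoot y
  Child⇒pathToRoot {x = x} {y = y} (x⊑y , (_ ∷ _ ∷ [] , (refl , refl , x~y ∷ _ , _) , _) , _)
    with adjacent⇒parent⊎child x~y
  ... | inj₁ eq = eq
  ... | inj₂ eq = contradiction (Descendant⇒∈pathToRoot x⊑y)
                                (Unique[x∷xs]⇒x∉xs (subst Unique eq (proj₂ (proj₂ (proj₂ (pathToRoot-isPath y))))))

  pathToRoot⇒Grandchild : ∀ {u z} → pathToRoot x ≡ x ∷ u ∷ pathToRoot z → Grandchild G r x z
  pathToRoot⇒Grandchild {x = x} {u} {z} eq with pathToRoot z | pathToRoot-isPath z | eq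
  ... | _ ∷ zs | refl , _ | eq′ =
    (pathToRoot x , pathToRoot-isPath x , subst (z ∈ₗ_) (≡.sym eq′) (there (there (here refl))))
    , (x ∷ u ∷ z ∷ [] , x⇝z , refl)
    , λ _ x⇝z′ → ≤-reflexive (≡.cong length (IsPath-unique G acyclic x⇝z x⇝z′))
    where
    x⇝z : IsPath G x z (x ∷ u ∷ z ∷ [])
    x⇝z with subst (IsPath G x r) eq′ (pathToRoot-isPath x)
    ... | refl , _ , x~u ∷ u~z ∷ _ , (x∉ ∷ u∉ ∷ _) =
      refl , refl , x~u ∷ u~z ∷ [-] , (All.head x∉ ∷ All.head (All.tail x∉) ∷ []) ∷ (All.head u∉ ∷ []) ∷ [] ∷ []

module Exchange (G : Graph n) (tree : IsTree G) (v : Fin n)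
                (S : Subset n) (S-dominating : Dominating G S)
                (A : Subset n) (A⊆a₁ : ∀ u → u ∈ A → InA₁ G S u)
                (d : ℕ) (A-depth : ∀ u → u ∈ A → Depth G v u d) where

  open RootedTree G tree v

  N : Subset n
  N = openNbhdSet G A ∩ N₁ G S

  S′ : Subset n
  S′ = (S ─ A) ∪ N

  A⊆S : x ∈ A → x ∈ S
  A⊆S x∈A = proj₁ (proj₁ (A⊆a₁ _ x∈A))

  ∈N⁺ : ∀ {a} → a ∈ A → Adjacent G a y → y ∈ N₁ G S → y ∈ N
  ∈N⁺ a∈A a~y y∈N₁ = x∈p∩q⁺ (∈openNbhdSet⁺ G a∈A a~y , y∈N₁)

  ∈N⁻ : y ∈ N → (∃ λ a → a ∈ A × Adjacent G a y) × y ∈ N₁ G S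
  ∈N⁻ y∈N with x∈p∩q⁻ _ _ y∈N
  ... | y∈N[A] , y∈N₁ = ∈openNbhdSet⁻ G y∈N[A] , y∈N₁

  ∈N⇒∉S : y ∈ N → y ∉ S
  ∈N⇒∉S = proj₁ ∘ ∈N₁⁻ G ∘ proj₂ ∘ ∈N⁻

  ∈S′⁺ˡ : x ∈ S → x ∉ A → x ∈ S′
  ∈S′⁺ˡ x∈S x∉A = x∈p∪q⁺ (inj₁ (x∈p∧x∉q⇒x∈p─q x∈S x∉A))

  ∈S′⁺ʳ : x ∈ N → x ∈ S′
  ∈S′⁺ʳ x∈N = x∈p∪q⁺ (inj₂ x∈N)

  ∈S′⁻ : x ∈ S′ → (x ∈ S × x ∉ A) ⊎ x ∈ N
  ∈S′⁻ x∈S′ with x∈p∪q⁻ (S ─ A) N x∈S′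
  ... | inj₁ x∈S─A = inj₁ (p─q⊆p S A x∈S─A , x∈p─q⇒x∉q x∈S─A)
  ... | inj₂ x∈N   = inj₂ x∈N

  N-neighbour-in-S⇒∈A : ∀ {s} → y ∈ N → s ∈ S → Adjacent G y s → s ∈ A
  N-neighbour-in-S⇒∈A {s = s} y∈N s∈S y~s with ∈N⁻ y∈N
  ... | (a , a∈A , a~y) , y∈N₁ =
    subst (_∈ A) (N₁-unique-neighbour G y∈N₁ (A⊆S a∈A) s∈S (adjacent-sym G a~y) y~s) a∈A

  neighbour-in-N : x ∈ A → ∃ λ w → w ∈ N × Adjacent G x w
  neighbour-in-N x∈A with InA₁⇒N₁-neighbour G (A⊆a₁ _ x∈A)
  ... | w , w∈N₁ , x~w = w , ∈N⁺ x∈A x~w w∈N₁ , x~w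

  exchange : Fin n → Fin n
  exchange x with x ∈? A
  ... | yes x∈A = proj₁ (neighbour-in-N x∈A)
  ... | no _    = x

  exchange-∈S′ : x ∈ S → exchange x ∈ S′
  exchange-∈S′ {x = x} x∈S with x ∈? A
  ... | yes x∈A = ∈S′⁺ʳ (proj₁ (proj₂ (neighbour-in-N x∈A)))
  ... | no x∉A  = ∈S′⁺ˡ x∈S x∉A

  exchange-injective : x ∈ S → y ∈ S → exchange x ≡ exchange y → x ≡ y
  exchange-injective {x = x} {y = y} x∈S y∈S eq with x ∈? A | y ∈? A
  ... | yes x∈A | yes y∈A =
    let w , w∈N , x~w = neighbour-in-N x∈A
        _ , _ , y~w′   = neighbour-in-N y∈A
    in N₁-unique-neighbour G (proj₂ (∈N⁻ w∈N)) x∈S y∈S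
                           (adjacent-sym G x~w) (adjacent-sym G (subst (Adjacent G y) (≡.sym eq) y~w′))
  ... | yes x∈A | no _    = let _ , w∈N , _ = neighbour-in-N x∈A in contradiction (subst (_∈ S) (≡.sym eq) y∈S) (∈N⇒∉S w∈N)
  ... | no _    | yes y∈A = let _ , w∈N , _ = neighbour-in-N y∈A in contradiction (subst (_∈ S) eq x∈S) (∈N⇒∉S w∈N)
  ... | no _    | no _    = eq

  ∣S∣≤∣S′∣ : ∣ S ∣ ≤ ∣ S′ ∣
  ∣S∣≤∣S′∣ = injectiveOn⇒∣p∣≤∣q∣ exchange exchange-∈S′ exchange-injective

  length-pathToRoot-A : x ∈ A → length (pathToRoot x) ≡ suc d
  length-pathToRoot-A x∈A = Depth⇒length≡ (A-depth _ x∈A)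

  neighbour-in-A⇒parent : ∀ {a} → y ∈ A → Descendant G v x y → a ∈ A → Adjacent G x a
                        → pathToRoot x ≡ x ∷ pathToRoot a
  neighbour-in-A⇒parent {y = y} {x = x} y∈A x⊑y a∈A x~a with adjacent⇒parent⊎child x~a
  ... | inj₁ eq = eq
  ... | inj₂ eq = contradiction (subst (_≤ length (pathToRoot x)) ∣y∣≡1+∣x∣ (Descendant⇒length≤ x⊑y)) 1+n≰n
    where
    ∣y∣≡1+∣x∣ : length (pathToRoot y) ≡ suc (length (pathToRoot x))
    ∣y∣≡1+∣x∣ = trans (length-pathToRoot-A y∈A) (trans (≡.sym (length-pathToRoot-A a∈A)) (≡.cong length eq))

  A-neighbour-unique : ∀ {a a′} → y ∈ A → Descendant G v x y → a ∈ A → a′ ∈ A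
                     → Adjacent G x a → Adjacent G x a′ → a ≡ a′
  A-neighbour-unique y∈A x⊑y a∈A a′∈A x~a x~a′ =
    pathToRoot-injective (∷-injectiveʳ (trans (≡.sym (neighbour-in-A⇒parent y∈A x⊑y a∈A x~a))
                                              (neighbour-in-A⇒parent y∈A x⊑y a′∈A x~a′)))

  A-dominated : x ∈ A → Dominated G S′ x
  A-dominated x∈A = let w , w∈N , x~w = neighbour-in-N x∈A in inj₂ (w , ∈S′⁺ʳ w∈N , x~w)

  descendant-dominated : y ∈ A → Descendant G v x y → Dominated G S′ x
  descendant-dominated {x = x} y∈A x⊑y with x ∈? A | x ∈? S
  ... | yes x∈A | _      = A-dominated x∈A
  ... | no x∉A  | yes x∈S = inj₁ (∈S′⁺ˡ x∈S x∉A)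
  ... | no x∉A  | no x∉S with S-dominating x
  ...   | inj₁ x∈S = contradiction x∈S x∉S
  ...   | inj₂ (s , s∈S , x~s) with s ∈? A
  ...     | no s∉A = inj₂ (s , ∈S′⁺ˡ s∈S s∉A , x~s)
  ...     | yes s∈A with x ∈? N₁ G S
  ...       | yes x∈N₁ = inj₁ (∈S′⁺ʳ (∈N⁺ s∈A (adjacent-sym G x~s) x∈N₁))
  ...       | no x∉N₁ with ∉N₁⇒another-neighbour G x∉S x∉N₁ s∈S x~s
  ...         | s′ , s′∈S , s′≢s , x~s′ with s′ ∈? A
  ...           | no s′∉A = inj₂ (s′ , ∈S′⁺ˡ s′∈S s′∉A , x~s′)
  ...           | yes s′∈A = contradiction (A-neighbour-unique y∈A x⊑y s′∈A s∈A x~s′ x~s) s′≢s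

  A-and-descendants-dominated : x ∈ A ⊎ (∃ λ y → y ∈ A × Descendant G v x y) → Dominated G S′ x
  A-and-descendants-dominated (inj₁ x∈A)            = A-dominated x∈A
  A-and-descendants-dominated (inj₂ (y , y∈A , x⊑y)) = descendant-dominated y∈A x⊑y

  ∈S∩S′⇒∉A : x ∈ S → x ∈ S′ → x ∉ A
  ∈S∩S′⇒∉A x∈S x∈S′ with ∈S′⁻ x∈S′
  ... | inj₁ (_ , x∉A) = x∉A
  ... | inj₂ x∈N       = contradiction x∈S (∈N⇒∉S x∈N)

  dominated-by-S′-x⇒dominated-by-S-x : x ∈ S → x ∉ A → Dominated G (S′ - x) x → Dominated G (S - x) x
  dominated-by-S′-x⇒dominated-by-S-x x∈S x∉A (inj₁ x∈S′-x) = contradiction refl (proj₂ (x∈p-y⇒x∈p∧x≢y x∈S′-x))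
  dominated-by-S′-x⇒dominated-by-S-x x∈S x∉A (inj₂ (w , w∈S′-x , x~w)) with x∈p-y⇒x∈p∧x≢y w∈S′-x
  ... | w∈S′ , w≢x with ∈S′⁻ w∈S′
  ...   | inj₁ (w∈S , _) = inj₂ (w , x∈p∧x≢y⇒x∈p-y w∈S w≢x , x~w)
  ...   | inj₂ w∈N       = contradiction (N-neighbour-in-S⇒∈A w∈N x∈S (adjacent-sym G x~w)) x∉A

  S-private⇒adjacent-to-N : ∀ {u} → x ∈ S → x ∉ A → Dominating G (S′ - x) → ¬ Dominated G (S - x) u
                          → u ∉ S × u ∉ S′ × Adjacent G x u × ∃ λ z → z ∈ N × Adjacent G u z
  S-private⇒adjacent-to-N {x = x} {u = u} x∈S x∉A S′-x-dominating u-private with u ≟ x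
  ... | yes refl = contradiction (dominated-by-S′-x⇒dominated-by-S-x x∈S x∉A (S′-x-dominating x)) u-private
  ... | no u≢x = u∉S , u∉S′ , adjacent-sym G u~x , N-neighbour
    where
    no-other-S-neighbour : ∀ {s} → s ∈ S → s ≢ x → ¬ Adjacent G u s
    no-other-S-neighbour s∈S s≢x u~s = u-private (inj₂ (_ , x∈p∧x≢y⇒x∈p-y s∈S s≢x , u~s))
    u∉S : u ∉ S
    u∉S u∈S = u-private (inj₁ (x∈p∧x≢y⇒x∈p-y u∈S u≢x))
    u~x : Adjacent G u x
    u~x with S-dominating u
    ... | inj₁ u∈S = contradiction u∈S u∉S
    ... | inj₂ (s , s∈S , u~s) with s ≟ x
    ...   | yes refl = u~s
    ...   | no s≢x   = contradiction u~s (no-other-S-neighbour s∈S s≢x)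
    u∉N : u ∉ N
    u∉N u∈N with ∈N⁻ u∈N
    ... | (a , a∈A , a~u) , _ =
      no-other-S-neighbour (A⊆S a∈A) (λ a≡x → x∉A (subst (_∈ A) a≡x a∈A)) (adjacent-sym G a~u)
    u∉S′ : u ∉ S′
    u∉S′ u∈S′ with ∈S′⁻ u∈S′
    ... | inj₁ (u∈S , _) = u∉S u∈S
    ... | inj₂ u∈N       = u∉N u∈N
    N-neighbour : ∃ λ z → z ∈ N × Adjacent G u z
    N-neighbour with S′-x-dominating u
    ... | inj₁ u∈S′-x = contradiction (proj₁ (x∈p-y⇒x∈p∧x≢y u∈S′-x)) u∉S′
    ... | inj₂ (z , z∈S′-x , u~z) with x∈p-y⇒x∈p∧x≢y z∈S′-x
    ...   | z∈S′ , z≢x with ∈S′⁻ z∈S′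
    ...     | inj₁ (z∈S , _) = contradiction u~z (no-other-S-neighbour z∈S z≢x)
    ...     | inj₂ z∈N       = z , z∈N , u~z

  module _ (N-children : ∀ y → y ∈ N → ∃ λ a → a ∈ A × Child G v y a) where

    length-pathToRoot-N : y ∈ N → length (pathToRoot y) ≡ suc (suc d)
    length-pathToRoot-N y∈N =
      let a , a∈A , y⋖a = N-children _ y∈N
      in trans (≡.cong length (Child⇒pathToRoot y⋖a)) (≡.cong suc (length-pathToRoot-A a∈A))

    N-isolated-in-S′ : ∀ {z} → y ∈ N → z ∈ S′ → ¬ Adjacent G y z
    N-isolated-in-S′ y∈N z∈S′ y~z with ∈S′⁻ z∈S′
    ... | inj₁ (z∈S , z∉A) = z∉A (N-neighbour-in-S⇒∈A y∈N z∈S y~z)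
    ... | inj₂ z∈N = adjacent⇒length≢ y~z (trans (length-pathToRoot-N y∈N) (≡.sym (length-pathToRoot-N z∈N)))

    N⊆a[S′] : y ∈ N → InA G S′ y
    N⊆a[S′] {y = y} y∈N = ∈S′⁺ʳ y∈N , λ S′-y-dominating → y-not-dominated (S′-y-dominating y)
      where
      y-not-dominated : ¬ Dominated G (S′ - y) y
      y-not-dominated (inj₁ y∈S′-y) = proj₂ (x∈p-y⇒x∈p∧x≢y y∈S′-y) refl
      y-not-dominated (inj₂ (w , w∈S′-y , y~w)) = N-isolated-in-S′ y∈N (proj₁ (x∈p-y⇒x∈p∧x≢y w∈S′-y)) y~w

    pathToRoot-via-N : ∀ {u z} → x ∈ S → u ∉ S → z ∈ N → Adjacent G x u → Adjacent G u z
                     → pathToRoot x ≡ x ∷ pathToRoot u × pathToRoot u ≡ u ∷ pathToRoot z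
    pathToRoot-via-N {x = x} {u = u} {z = z} x∈S u∉S z∈N x~u u~z with N-children _ z∈N
    ... | a , a∈A , z⋖a with adjacent⇒parent⊎child u~z
    ...   | inj₂ z-child-of-u = contradiction (subst (_∈ S) a≡u (A⊆S a∈A)) u∉S
      where
      a≡u : a ≡ u
      a≡u = pathToRoot-injective (∷-injectiveʳ (trans (≡.sym (Child⇒pathToRoot z⋖a)) z-child-of-u))
    ...   | inj₁ u-child-of-z with adjacent⇒parent⊎child x~u
    ...     | inj₁ x-child-of-u = x-child-of-u , u-child-of-z
    ...     | inj₂ u-child-of-x = contradiction (subst (_∈ S) x≡z x∈S) (∈N⇒∉S z∈N)
      where
      x≡z : x ≡ z
      x≡z = pathToRoot-injective (∷-injectiveʳ (trans (≡.sym u-child-of-x) u-child-of-z))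

    a[S]∩S′-a[S′] : InA G S x → x ∈ S′ → ¬ InA G S′ x
                  → (∃ λ y → y ∈ N × Grandchild G v x y) × (∀ p → Child G v x p → p ∉ S′)
    a[S]∩S′-a[S′] {x = x} x∈a[S]@(x∈S , _) x∈S′ x∉a[S′] =
      let u , u-private = InA⇒∃undominated G x∈a[S]
          u∉S , u∉S′ , x~u , z , z∈N , u~z =
            S-private⇒adjacent-to-N x∈S (∈S∩S′⇒∉A x∈S x∈S′) (¬InA⇒dominating G x∈S′ x∉a[S′]) u-private
          x⋖u , u⋖z = pathToRoot-via-N x∈S u∉S z∈N x~u u~z
      in (z , z∈N , pathToRoot⇒Grandchild (trans x⋖u (≡.cong (x ∷_) u⋖z)))
       , λ p x⋖p → subst (_∉ S′) (pathToRoot-injective (∷-injectiveʳ (trans (≡.sym x⋖u) (Child⇒pathToRoot x⋖p))))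
                         u∉S′

lemma9 : (n : ℕ) (G : Graph n) → IsTree G → (v : Fin n)
  → (S : Subset n) → Dominating G S
  → (A : Subset n) → (∀ u → u ∈ A → InA₁ G S u)
  → (∃ λ d → ∀ u → u ∈ A → Depth G v u d)
  → let N  = openNbhdSet G A ∩ N₁ G S
        S′ = (S ─ A) ∪ N
    in (∣ S ∣ ≤ ∣ S′ ∣)
     × (∀ x → (x ∈ A ⊎ (∃ λ y → y ∈ A × Descendant G v x y)) → Dominated G S′ x)
     × (Dominating G S′
        → (∀ y → y ∈ N → ∃ λ a → a ∈ A × Child G v y a)
        → ((∀ y z → y ∈ N → z ∈ S′ → z ≢ y → ¬ Adjacent G y z)
           × (∀ y → y ∈ N → InA G S′ y))
        × (∀ x → InA G S x → x ∈ S′ → ¬ InA G S′ x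
           → (∃ λ y → y ∈ N × Grandchild G v x y)
           × (∀ p → Child G v x p → p ∉ S′)))
lemma9 n G tree v S S-dominating A A⊆a₁ (d , A-depth) =
    ∣S∣≤∣S′∣
  , (λ x → A-and-descendants-dominated)
    -- (iii) and (iv) hold without S′ being dominating.
  , λ _ N-children →
      ( (λ y z y∈N z∈S′ _ → N-isolated-in-S′ N-children y∈N z∈S′)
      , (λ y → N⊆a[S′] N-children) )
    , (λ x → a[S]∩S′-a[S′] N-children)
  where open Exchange G tree v S S-dominating A A⊆a₁ d A-depth
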